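{- If Church's thesis holds, then there is no embedding $\big(\sum_{f:\mathbb N\to\mathcal L(\mathbb N)}\mathsf{isComputable}(f)\big)\to\mathbb N$.
   Context: Type theory: Martin-Löf type theory with universe $\mathcal U$, function extensionality, proposition extensionality and propositional truncations. $\mathcal L(Y):=\sum_{P:\mathcal U}\operatorname{isProp}(P)\times(P\to Y)$ with $\eta(y)=(1,-,\lambda u.y)$. Recursive machine: a pair $m=(i,s)$ of unary primitive recursive functions, $s$ read as $\mathbb N\to\mathbb N+\mathbb N$ via $\mathrm{inl}(n)=2n$, $\mathrm{inr}(n)=2n+1$; $\operatorname{run}_k(m,x):=s'^k(\mathrm{inl}(i(x)))$ with $s'(\mathrm{inl}\,x)=s(x)$, $s'(\mathrm{inr}\,y)=\mathrm{inr}\,y$; $\operatorname{eval}(m)(x)$ is the partial element with extent $\sum_y\lVert\sum_k\operatorname{run}_k(m,x)=\mathrm{inr}\,y\rVert$ and value the first projection. $\mathsf{isComputable}(f):=\lVert\sum_m f=\operatorname{eval}(m)\rVert$. Church's thesis: for all $g:\mathbb N\to\mathbb N$, $\mathsf{isComputable}(\eta\circ g)$. An embedding is a map whose fibers are propositions. -}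

module Defs where

open import Level using (Level; _⊔_; Setω) renaming (suc to lsuc; zero to lzero)
open import Data.Nat using (ℕ; zero; suc)
open import Data.Nat.Properties using (≡-irrelevant)
open import Data.Fin using (Fin)
open import Data.Vec using (Vec; []; _∷_; lookup)
open import Data.Product using (Σ; _×_; _,_; proj₁; proj₂)
open import Data.Sum using (_⊎_; inj₁; inj₂)
open import Data.Unit using (⊤; tt)
open import Function using (_∘_)
open import Relation.Binary.PropositionalEquality
  using (_≡_; refl; sym; trans; cong; subst)

isProp : ∀ {ℓ} → Set ℓ → Set ℓ
isProp A = (x y : A) → x ≡ y

isEmbedding : ∀ {a b} {A : Set a} {B : Set b} → (A → B) → Set (a ⊔ b)
isEmbedding {A = A} e = ∀ b → isProp (Σ A λ x → e x ≡ b)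

FunExt : Setω
FunExt = ∀ {a b} {A : Set a} {B : A → Set b} {f g : (x : A) → B x}
       → (∀ x → f x ≡ g x) → f ≡ g

PropExt : Set₁
PropExt = ∀ {P Q : Set} → isProp P → isProp Q → (P → Q) → (Q → P) → P ≡ Q

record PropTrunc : Setω where
  field
    ∥_∥      : ∀ {ℓ} → Set ℓ → Set ℓ
    ∣_∣      : ∀ {ℓ} {A : Set ℓ} → A → ∥ A ∥
    ∥∥-isProp : ∀ {ℓ} {A : Set ℓ} → isProp ∥ A ∥
    ∥∥-rec   : ∀ {ℓ ℓ'} {A : Set ℓ} {B : Set ℓ'} → isProp B → (A → B) → ∥ A ∥ → B

𝓛 : Set → Set₁
𝓛 Y = Σ Set λ P → isProp P × (P → Y)

η : {Y : Set} → Y → 𝓛 Y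
η y = ⊤ , (λ _ _ → refl) , (λ _ → y)

data PR : ℕ → Set where
  zeroᶠ : ∀ {n} → PR n
  succᶠ : PR 1
  proj  : ∀ {n} → Fin n → PR n
  comp  : ∀ {k n} → PR k → Vec (PR n) k → PR n
  prec  : ∀ {n} → PR n → PR (suc (suc n)) → PR (suc n)

mutual
  ⟦_⟧ : ∀ {n} → PR n → Vec ℕ n → ℕ
  ⟦ zeroᶠ ⟧ xs = 0
  ⟦ succᶠ ⟧ (x ∷ []) = suc x
  ⟦ proj i ⟧ xs = lookup xs i
  ⟦ comp f gs ⟧ xs = ⟦ f ⟧ (⟦ gs ⟧* xs)
  ⟦ prec f g ⟧ (zero ∷ xs) = ⟦ f ⟧ xs
  ⟦ prec f g ⟧ (suc y ∷ xs) = ⟦ g ⟧ (y ∷ ⟦ prec f g ⟧ (y ∷ xs) ∷ xs)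

  ⟦_⟧* : ∀ {k n} → Vec (PR n) k → Vec ℕ n → Vec ℕ k
  ⟦ [] ⟧* xs = []
  ⟦ g ∷ gs ⟧* xs = ⟦ g ⟧ xs ∷ ⟦ gs ⟧* xs

⟦_⟧₁ : PR 1 → ℕ → ℕ
⟦ f ⟧₁ x = ⟦ f ⟧ (x ∷ [])

Machine : Set
Machine = PR 1 × PR 1

-- ℕ read as ℕ + ℕ : inl n = 2n, inr n = 2n+1
decode : ℕ → ℕ ⊎ ℕ
decode zero = inj₁ 0
decode (suc zero) = inj₂ 0
decode (suc (suc n)) with decode n
... | inj₁ a = inj₁ (suc a)
... | inj₂ b = inj₂ (suc b)

step : Machine → ℕ ⊎ ℕ → ℕ ⊎ ℕ
step (i , s) (inj₁ x) = decode (⟦ s ⟧₁ x)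
step (i , s) (inj₂ y) = inj₂ y

iter : ∀ {A : Set} → ℕ → (A → A) → A → A
iter zero f a = a
iter (suc k) f a = f (iter k f a)

run : ℕ → Machine → ℕ → ℕ ⊎ ℕ
run k m@(i , s) x = iter k (step m) (inj₁ (⟦ i ⟧₁ x))

module _ (T : PropTrunc) where
  open PropTrunc T

  private
    inj₂-inj : ∀ {a b : ℕ} → _≡_ {A = ℕ ⊎ ℕ} (inj₂ a) (inj₂ b) → a ≡ b
    inj₂-inj refl = refl

    step-inr : ∀ m j y → iter j (step m) (inj₂ y) ≡ inj₂ y
    step-inr m zero y = refl
    step-inr m (suc j) y rewrite step-inr m j y = refl

    iter-+ : ∀ {A : Set} (f : A → A) a j k → iter (j Data.Nat.+ k) f a ≡ iter j f (iter k f a)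
    iter-+ f a zero k = refl
    iter-+ f a (suc j) k = cong f (iter-+ f a j k)

    later : ∀ m a k y j → iter k (step m) a ≡ inj₂ y → iter (j Data.Nat.+ k) (step m) a ≡ inj₂ y
    later m a k y j p = trans (iter-+ (step m) a j k) (trans (cong (iter j (step m)) p) (step-inr m j y))

    det₁ : ∀ m a k k' y y' → k Data.Nat.≤ k' → iter k (step m) a ≡ inj₂ y → iter k' (step m) a ≡ inj₂ y' → y ≡ y'
    det₁ m a k k' y y' le p q = inj₂-inj (trans (sym (later m a k y (k' Data.Nat.∸ k) p))
      (trans (cong (λ n → iter n (step m) a) (Data.Nat.Properties.m∸n+n≡m le)) q))

    det : ∀ m x k k' y y' → run k m x ≡ inj₂ y → run k' m x ≡ inj₂ y' → y ≡ y'
    det m x k k' y y' p q with Data.Nat.Properties.≤-total k k'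
    ... | inj₁ le = det₁ m _ k k' y y' le p q
    ... | inj₂ le = sym (det₁ m _ k' k y' y le q p)

    ext : Machine → ℕ → Set
    ext m x = Σ ℕ λ y → ∥ Σ ℕ (λ k → run k m x ≡ inj₂ y) ∥

    ext-prop : ∀ m x → isProp (ext m x)
    ext-prop m x (y , t) (y' , t') = go (∥∥-rec (≡-irrelevant) (λ { (k , p) →
        ∥∥-rec ≡-irrelevant (λ { (k' , q) → det m x k k' y y' p q }) t' }) t)
      where
        go : y ≡ y' → (y , t) ≡ (y' , t')
        go refl = cong (y ,_) (∥∥-isProp t t')

  eval : Machine → ℕ → 𝓛 ℕ
  eval m x = ext m x , ext-prop m x , proj₁

  isComputable : (ℕ → 𝓛 ℕ) → Set₁
  isComputable f = ∥ Σ Machine (λ m → f ≡ eval m) ∥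

  ChurchsThesis : Set₁
  ChurchsThesis = (g : ℕ → ℕ) → isComputable (η ∘ g)

  ComputablePartialFunctions : Set₁
  ComputablePartialFunctions = Σ (ℕ → 𝓛 ℕ) isComputable

-- An embedding into ℕ would make equality of computable partial functions
-- decidable.  Enumerate all machines as M₀, M₁, … and let Cₙ be the
-- constant function with value eval Mₙ n, which is computable because a machine
-- may ignore its input.  Deciding whether Cₙ is the constant function η 0 gives a
-- total g with g n = 1 iff eval Mₙ n = η 0; by Church's thesis η ∘ g = eval Mₙ for
-- some n, and then eval Mₙ n = η (g n) contradicts either answer.

module Submission where

open import Defs
open import Data.Nat using (ℕ; zero; suc; _+_; _≤_; _⊔_; s≤s; _≟_)
open import Data.Nat.Properties using (+-suc; +-identityʳ; m≤m⊔n; m≤n⊔m; ≤-trans; ≤-refl)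
open import Data.Nat.DivMod using (_mod_; m<n⇒m%n≡m)
open import Data.Fin using (Fin; toℕ)
open import Data.Fin.Properties using (toℕ<n; fromℕ<-cong; fromℕ<-toℕ)
open import Data.Vec using (Vec; []; _∷_)
open import Data.Product using (Σ; _×_; _,_; proj₁; proj₂)
open import Data.Sum using (inj₁; inj₂)
open import Data.Unit using (tt)
open import Data.Empty using (⊥)
open import Data.Bool using (if_then_else_)
open import Function using (_∘_)
open import Relation.Nullary using (¬_; Dec; yes; no)
open import Relation.Nullary.Decidable using (isYes; map′)
open import Relation.Binary.Definitions using (DecidableEquality)
open import Relation.Binary.PropositionalEquality
  using (_≡_; refl; sym; trans; cong; cong₂; cong-app)
import Axiom.UniquenessOfIdentityProofs as UIP

-- unpair walks each diagonal a + b = d from (0 , d) to (d , 0), then moves on to (0 , d + 1).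
next : ℕ × ℕ → ℕ × ℕ
next (a , suc b) = suc a , b
next (a , zero)  = zero , suc a

unpair : ℕ → ℕ × ℕ
unpair zero    = 0 , 0
unpair (suc n) = next (unpair n)

unpair-onto-diagonal : ∀ d a b → a + b ≡ d → Σ ℕ λ x → unpair x ≡ (a , b)
unpair-onto-diagonal d (suc a) b a+b≡d
  with unpair-onto-diagonal d a (suc b) (trans (+-suc a b) a+b≡d)
... | x , eq = suc x , cong next eq
unpair-onto-diagonal zero    zero zero    _ = 0 , refl
unpair-onto-diagonal (suc d) zero (suc b) b≡d with unpair-onto-diagonal d d 0 (+-identityʳ d)
... | x , eq = suc x , trans (cong next eq) (cong (0 ,_) (sym b≡d))

code : ℕ → ℕ → ℕ
code a b = proj₁ (unpair-onto-diagonal (a + b) a b refl)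

unpair-code : ∀ a b → unpair (code a b) ≡ (a , b)
unpair-code a b = proj₂ (unpair-onto-diagonal (a + b) a b refl)

viaUnpair : ∀ {ℓ} {A : Set ℓ} → (ℕ → ℕ → A) → ℕ → A
viaUnpair g x = g (proj₁ (unpair x)) (proj₂ (unpair x))

viaUnpair-code : ∀ {ℓ} {A : Set ℓ} (g : ℕ → ℕ → A) a b → viaUnpair g (code a b) ≡ g a b
viaUnpair-code g a b = cong (λ p → g (proj₁ p) (proj₂ p)) (unpair-code a b)

toℕ-mod : ∀ {m} (i : Fin (suc m)) → toℕ i mod suc m ≡ i
toℕ-mod i =
  trans (fromℕ<-cong _ _ (m<n⇒m%n≡m (toℕ<n i)) _ (toℕ<n i)) (fromℕ<-toℕ i (toℕ<n i))

projection : (n : ℕ) → ℕ → PR n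
projection zero    r = zeroᶠ
projection (suc m) r = proj (r mod suc m)

successor : (n : ℕ) → PR n
successor 1 = succᶠ
successor _ = zeroᶠ

-- The fuel bounds the nesting depth, and it is
-- enumerated alongside the code in enumPR₁.
mutual
  decodePR : (fuel n : ℕ) → ℕ → PR n
  decodePR zero       n x = zeroᶠ
  decodePR (suc fuel) n   = viaUnpair (decodeShape fuel n)

  decodeShape : (fuel n : ℕ) → ℕ → ℕ → PR n
  decodeShape fuel n 1 r = successor n
  decodeShape fuel n 2 r = projection n r
  decodeShape fuel n 3 r = viaUnpair (λ k → viaUnpair (decodeComp fuel n k)) r
  decodeShape fuel n 4 r = viaUnpair (decodePrec fuel n) r
  decodeShape fuel n _ r = zeroᶠ

  decodeComp : (fuel n k : ℕ) → ℕ → ℕ → PR n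
  decodeComp fuel n k a b = comp (decodePR fuel k a) (decodePRs fuel k n b)

  decodePrec : (fuel n : ℕ) → ℕ → ℕ → PR n
  decodePrec fuel zero    a b = zeroᶠ
  decodePrec fuel (suc n) a b = prec (decodePR fuel n a) (decodePR fuel (suc (suc n)) b)

  decodePRs : (fuel k n : ℕ) → ℕ → Vec (PR n) k
  decodePRs fuel zero    n x = []
  decodePRs fuel (suc k) n x = viaUnpair (decodeCons fuel k n) x

  decodeCons : (fuel k n : ℕ) → ℕ → ℕ → Vec (PR n) (suc k)
  decodeCons fuel k n a b = decodePR fuel n a ∷ decodePRs fuel k n b

mutual
  depth : ∀ {n} → PR n → ℕ
  depth zeroᶠ       = 1
  depth succᶠ       = 1
  depth (proj _)    = 1
  depth (comp f gs) = suc (depth f ⊔ depths gs)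
  depth (prec f g)  = suc (depth f ⊔ depth g)

  depths : ∀ {k n} → Vec (PR n) k → ℕ
  depths []       = 0
  depths (g ∷ gs) = depth g ⊔ depths gs

decodePR-code : ∀ fuel n t r → decodePR (suc fuel) n (code t r) ≡ decodeShape fuel n t r
decodePR-code fuel n = viaUnpair-code (decodeShape fuel n)

mutual
  decodePR-surjective : ∀ {n} (c : PR n) fuel → depth c ≤ fuel → Σ ℕ λ x → decodePR fuel n x ≡ c
  decodePR-surjective zeroᶠ (suc fuel) _ = 0 , refl
  decodePR-surjective succᶠ (suc fuel) _ = code 1 0 , decodePR-code fuel 1 1 0
  decodePR-surjective (proj {suc m} i) (suc fuel) _ =
    code 2 (toℕ i) , trans (decodePR-code fuel (suc m) 2 (toℕ i)) (cong proj (toℕ-mod i))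
  decodePR-surjective {n} (comp {k} f gs) (suc fuel) (s≤s le)
    with decodePR-surjective f fuel (≤-trans (m≤m⊔n _ _) le)
       | decodePRs-surjective gs fuel (≤-trans (m≤n⊔m (depth f) _) le)
  ... | a , refl | b , refl = code 3 (code k (code a b)) ,
    trans (decodePR-code fuel n 3 (code k (code a b)))
      (trans (viaUnpair-code (λ k → viaUnpair (decodeComp fuel n k)) k (code a b))
             (viaUnpair-code (decodeComp fuel n k) a b))
  decodePR-surjective {suc n} (prec f g) (suc fuel) (s≤s le)
    with decodePR-surjective f fuel (≤-trans (m≤m⊔n _ _) le)
       | decodePR-surjective g fuel (≤-trans (m≤n⊔m (depth f) _) le)
  ... | a , refl | b , refl =
    code 4 (code a b) ,
    trans (decodePR-code fuel (suc n) 4 (code a b)) (viaUnpair-code (decodePrec fuel (suc n)) a b)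

  decodePRs-surjective : ∀ {k n} (gs : Vec (PR n) k) fuel → depths gs ≤ fuel
                       → Σ ℕ λ x → decodePRs fuel k n x ≡ gs
  decodePRs-surjective [] fuel _ = 0 , refl
  decodePRs-surjective {suc k} {n} (g ∷ gs) fuel le
    with decodePR-surjective g fuel (≤-trans (m≤m⊔n _ _) le)
       | decodePRs-surjective gs fuel (≤-trans (m≤n⊔m (depth g) _) le)
  ... | a , refl | b , refl = code a b , viaUnpair-code (decodeCons fuel k n) a b

enumPR₁ : ℕ → PR 1
enumPR₁ = viaUnpair (λ fuel → decodePR fuel 1)

enumPR₁-surjective : ∀ c → Σ ℕ λ x → enumPR₁ x ≡ c
enumPR₁-surjective c with decodePR-surjective c (depth c) ≤-refl
... | x , eq = code (depth c) x , trans (viaUnpair-code (λ fuel → decodePR fuel 1) (depth c) x) eq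

enumMachine : ℕ → Machine
enumMachine = viaUnpair (λ a b → enumPR₁ a , enumPR₁ b)

enumMachine-surjective : ∀ M → Σ ℕ λ x → enumMachine x ≡ M
enumMachine-surjective (i , s) with enumPR₁-surjective i | enumPR₁-surjective s
... | a , refl | b , refl = code a b , viaUnpair-code (λ a b → enumPR₁ a , enumPR₁ b) a b

constᴾᴿ : ℕ → PR 1
constᴾᴿ zero    = zeroᶠ
constᴾᴿ (suc k) = comp succᶠ (constᴾᴿ k ∷ [])

⟦constᴾᴿ⟧ : ∀ k x → ⟦ constᴾᴿ k ⟧₁ x ≡ k
⟦constᴾᴿ⟧ zero    x = refl
⟦constᴾᴿ⟧ (suc k) x = cong suc (⟦constᴾᴿ⟧ k x)

fixInput : Machine → ℕ → Machine
fixInput (i , s) n = comp i (constᴾᴿ n ∷ []) , s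

step-ignores-initialiser : ∀ i i′ s a → step (i , s) a ≡ step (i′ , s) a
step-ignores-initialiser i i′ s (inj₁ x) = refl
step-ignores-initialiser i i′ s (inj₂ y) = refl

iter-cong : ∀ {A : Set} {f g : A → A} → (∀ a → f a ≡ g a) → ∀ k a → iter k f a ≡ iter k g a
iter-cong f≗g zero    a = refl
iter-cong {g = g} f≗g (suc k) a = trans (f≗g _) (cong g (iter-cong f≗g k a))

run-fixInput : ∀ k M n x → run k (fixInput M n) x ≡ run k M n
run-fixInput k (i , s) n x =
  trans (iter-cong (step-ignores-initialiser _ i s) k _)
        (cong (λ z → iter k (step (i , s)) (inj₁ (⟦ i ⟧₁ z))) (⟦constᴾᴿ⟧ n x))

isProp⇒UIP : ∀ {ℓ} {P : Set ℓ} → isProp P → {x y : P} → isProp (x ≡ y)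
isProp⇒UIP φ = UIP.Constant⇒UIP.≡-irrelevant (λ {x} {y} _ → φ x y) (λ _ _ → refl)

isProp-isProp : FunExt → {P : Set} → isProp (isProp P)
isProp-isProp fe φ ψ = fe λ x → fe λ y → isProp⇒UIP φ (φ x y) (ψ x y)

extent : {Y : Set} → 𝓛 Y → Set
extent = proj₁

value : {Y : Set} (l : 𝓛 Y) → extent l → Y
value l = proj₂ (proj₂ l)

𝓛-≡ : FunExt → PropExt → {Y : Set} (l₁ l₂ : 𝓛 Y) (f : extent l₁ → extent l₂)
    → (extent l₂ → extent l₁) → (∀ p → value l₁ p ≡ value l₂ (f p)) → l₁ ≡ l₂
𝓛-≡ fe pe (P , φ , v) (Q , ψ , w) f g v≡w∘f = go (pe φ ψ f g) ψ w f v≡w∘f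
  where
    go : (P≡Q : P ≡ Q) (ψ : isProp Q) (w : Q → _) (f : P → Q)
       → (∀ p → v p ≡ w (f p)) → (P , φ , v) ≡ (Q , ψ , w)
    go refl ψ w f v≡w∘f =
      cong₂ (λ φ v → P , φ , v) (isProp-isProp fe φ ψ) (fe λ p → trans (v≡w∘f p) (cong w (ψ _ _)))

value-η : {Y : Set} {l : 𝓛 Y} {y : Y} → l ≡ η y → ∀ p → value l p ≡ y
value-η refl p = refl

η-injective : {Y : Set} {y y′ : Y} → η y ≡ η y′ → y ≡ y′
η-injective eq = value-η eq tt

isEmbedding⇒injective : ∀ {a b} {A : Set a} {B : Set b} {e : A → B}
                      → isEmbedding e → ∀ {x y} → e x ≡ e y → x ≡ y
isEmbedding⇒injective emb {x} {y} ex≡ey = cong proj₁ (emb _ (x , ex≡ey) (y , refl))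

isEmbedding⇒DecidableEquality : ∀ {a b} {A : Set a} {B : Set b} {e : A → B}
                              → DecidableEquality B → isEmbedding e → DecidableEquality A
isEmbedding⇒DecidableEquality {e = e} _≟_ emb x y = map′ (isEmbedding⇒injective emb) (cong e) (e x ≟ e y)

module _ (fe : FunExt) (pe : PropExt) (T : PropTrunc) where
  open PropTrunc T

  ∥∥-map : ∀ {a b} {A : Set a} {B : Set b} → (A → B) → ∥ A ∥ → ∥ B ∥
  ∥∥-map f = ∥∥-rec ∥∥-isProp (∣_∣ ∘ f)

  eval-fixInput : ∀ M n x → eval T (fixInput M n) x ≡ eval T M n
  eval-fixInput M n x = 𝓛-≡ fe pe (eval T (fixInput M n) x) (eval T M n)
    (λ { (y , t) → y , ∥∥-map (λ { (k , eq) → k , trans (sym (run-fixInput k M n x)) eq }) t })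
    (λ { (y , t) → y , ∥∥-map (λ { (k , eq) → k , trans (run-fixInput k M n x) eq }) t })
    (λ _ → refl)

  const-eval-isComputable : ∀ M n → isComputable T (λ _ → eval T M n)
  const-eval-isComputable M n = ∣ fixInput M n , sym (fe (eval-fixInput M n)) ∣

  computable-≡ : {f g : ℕ → 𝓛 ℕ} {p : isComputable T f} {q : isComputable T g}
               → f ≡ g → _≡_ {A = ComputablePartialFunctions T} (f , p) (g , q)
  computable-≡ {f} {p = p} {q} refl = cong (f ,_) (∥∥-isProp p q)

  ¬DecidableEquality-computable : ChurchsThesis T → ¬ DecidableEquality (ComputablePartialFunctions T)
  ¬DecidableEquality-computable ct _≟_ = ∥∥-rec (λ ()) diagonal-computed (ct diagonal)
    where
      zeroFunction : ComputablePartialFunctions T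
      zeroFunction = (λ _ → η 0) , ct (λ _ → 0)

      constant-at : ℕ → ComputablePartialFunctions T
      constant-at n = (λ _ → eval T (enumMachine n) n) , const-eval-isComputable (enumMachine n) n

      indicator : ∀ {ℓ} {X : Set ℓ} → Dec X → ℕ
      indicator d = if isYes d then 1 else 0

      diagonal : ℕ → ℕ
      diagonal n = indicator (constant-at n ≟ zeroFunction)

      diagonal-differs : ∀ n (d : Dec (constant-at n ≡ zeroFunction))
                       → eval T (enumMachine n) n ≡ η (indicator d) → ⊥
      diagonal-differs n (yes c≡0) eval≡1 with η-injective (trans (sym eval≡1) (cong (λ c → proj₁ c n) c≡0))
      ... | ()
      diagonal-differs n (no c≢0) eval≡0 = c≢0 (computable-≡ (fe λ _ → eval≡0))

      diagonal-computed : Σ Machine (λ M → η ∘ diagonal ≡ eval T M) → ⊥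
      diagonal-computed (M , diagonal≡M) with enumMachine-surjective M
      ... | n , refl = diagonal-differs n (constant-at n ≟ zeroFunction) (sym (cong-app diagonal≡M n))

theorem9p10 : FunExt → PropExt → (T : PropTrunc) → ChurchsThesis T
            → ¬ (Σ (ComputablePartialFunctions T → ℕ) isEmbedding)
theorem9p10 fe pe T ct (e , emb) =
  ¬DecidableEquality-computable fe pe T ct (isEmbedding⇒DecidableEquality _≟_ emb)
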